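{- Let $T$ be a tree of order at least four with no vertex of degree two, and let $G$ be its Halin graph, with $C$ the cycle of $G$ induced on the set of leaves of $T$. If $f$ is an automorphism of $G$ that fixes every vertex of $C$, then $f$ is the identity automorphism of $G$.
   Context: Given a tree $T$ with at least four vertices and no vertex of degree two, embedded in the plane without edge crossings, the Halin graph of $T$ is obtained from $T$ by adding a cycle $C$ through all leaves of $T$, connecting them in their clockwise order in the embedding. -}

module Defs where

open import Data.Nat using (ℕ; zero; suc; _≤_)
open import Data.Fin using (Fin; _≟_)
open import Data.List using (List; []; _∷_; _++_; length)
open import Data.List.Membership.Propositional using (_∈_)
open import Data.List.Relation.Unary.Unique.Propositional using (Unique)
open import Data.List.Relation.Unary.Linked using (Linked)
open import Data.Maybe using (Maybe; just; nothing)
open import Data.Product using (_×_; _,_; Σ; ∃; proj₁; proj₂)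
open import Data.Sum using (_⊎_)
open import Data.Empty using (⊥)
open import Relation.Nullary using (¬_; yes; no)
open import Relation.Binary.PropositionalEquality using (_≡_)
open import Relation.Binary.Construct.Closure.ReflexiveTransitive using (Star)
open import Function.Definitions using (Bijective)

-- A plane tree on vertex set Fin n is given by a rotation system:
-- rot v lists the neighbours of v in clockwise order around v.
-- (For a tree every rotation system is a plane embedding, and every
-- plane embedding of a tree is determined up to isotopy by its rotation
-- system.)

RotSys : ℕ → Set
RotSys n = Fin n → List (Fin n)

module _ {n : ℕ} (rot : RotSys n) where

  Adj : Fin n → Fin n → Set
  Adj u v = v ∈ rot u

  deg : Fin n → ℕ
  deg v = length (rot v)

  IsLeaf : Fin n → Set
  IsLeaf v = deg v ≡ 1

  IsSimpleRot : Set
  IsSimpleRot = (∀ v → Unique (rot v))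
              × (∀ u v → Adj u v → Adj v u)
              × (∀ v → ¬ Adj v v)

  Connected : Set
  Connected = ∀ u v → Star Adj u v

  IsCycle : List (Fin n) → Set
  IsCycle [] = ⊥
  IsCycle (x ∷ xs) = (3 ≤ length (x ∷ xs)) × Unique (x ∷ xs)
                   × Linked Adj ((x ∷ xs) ++ (x ∷ []))

  Acyclic : Set
  Acyclic = ∀ xs → ¬ IsCycle xs

  IsPlaneTree : Set
  IsPlaneTree = IsSimpleRot × Connected × Acyclic

  headOr : Fin n → List (Fin n) → Fin n
  headOr d [] = d
  headOr d (x ∷ _) = x

  after : Fin n → List (Fin n) → Maybe (Fin n)
  after u [] = nothing
  after u (x ∷ xs) = go x xs
    where
    go : Fin n → List (Fin n) → Maybe (Fin n)
    go x [] = nothing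
    go x (y ∷ ys) with u ≟ x
    ... | yes _ = just y
    ... | no _ = go y ys

  succRot : Fin n → Fin n → Fin n
  succRot v u with after u (rot v)
  ... | just w = w
  ... | nothing = headOr u (rot v)

  Dart : Set
  Dart = Fin n × Fin n

  -- arriving at v along (u , v), leave along the next edge in the rotation at v
  step : Dart → Dart
  step (u , v) = (v , succRot v u)

  iter : ℕ → Dart → Dart
  iter zero d = d
  iter (suc k) d = step (iter k d)

  leafDart : Fin n → Dart
  leafDart l = (l , headOr l (rot l))

  -- l' is the leaf following the leaf l in the cyclic order of leaves
  -- given by the embedding (first leaf reached by the boundary walk
  -- starting at l)
  NextLeaf : Fin n → Fin n → Set
  NextLeaf l l' = IsLeaf l × IsLeaf l' ×
    Σ ℕ λ j → (proj₂ (iter j (leafDart l)) ≡ l')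
            × (∀ i → suc i Data.Nat.≤ j → ¬ IsLeaf (proj₂ (iter i (leafDart l))))

  CycleAdj : Fin n → Fin n → Set
  CycleAdj u v = NextLeaf u v ⊎ NextLeaf v u

  HalinAdj : Fin n → Fin n → Set
  HalinAdj u v = Adj u v ⊎ CycleAdj u v

IsAutomorphism : {n : ℕ} → (Fin n → Fin n → Set) → (Fin n → Fin n) → Set
IsAutomorphism A f = Bijective _≡_ _≡_ f
  × (∀ u v → (A u v → A (f u) (f v)) × (A (f u) (f v) → A u v))

module Submission where

-- 1. Finite trees have no "branching set": a set P of vertices in which
--    every vertex has, avoiding any one prescribed vertex, a neighbour in P.
--    Otherwise a path could be grown inside P forever, one new vertex at a
--    time (a repeated vertex would close a cycle), contradicting finiteness.
-- 2. A vertex of a tree that is neither a leaf nor of degree two has three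
--    distinct neighbours, and no two distinct vertices of a tree share two
--    distinct neighbours (that would be a 4-cycle).
-- 3. The Halin automorphism: the cycle C only joins leaves, and leaves are
--    fixed, so a moved vertex x is mapped to a non-leaf and each tree edge
--    x–a with a fixed is mapped to the tree edge (f x)–a.  Hence x and f x
--    share all fixed neighbours of x, so x has at most one fixed neighbour;
--    as x has at least three neighbours, the moved vertices form a
--    branching set, which is empty by part 1.

open import Defs
open import Data.Nat using (ℕ; zero; suc; _≤_; s≤s; z≤n)
open import Data.Nat.Properties using (≤-trans; 1+n≰n; n≤1+n)
open import Data.Fin using (Fin; _≟_)
open import Data.Fin.Properties using (injective⇒≤)
open import Data.List using (List; []; _∷_; _++_; length; lookup)
open import Data.List.Membership.Propositional using (_∈_)
open import Data.List.Membership.Propositional.Properties using (∈-lookup)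
import Data.List.Membership.DecPropositional as DecMembership
open import Data.List.Relation.Unary.Any using (here; there)
open import Data.List.Relation.Unary.All as All using (All; []; _∷_)
open import Data.List.Relation.Unary.All.Properties using (¬Any⇒All¬)
open import Data.List.Relation.Unary.AllPairs using ([]; _∷_)
open import Data.List.Relation.Unary.Unique.Propositional using (Unique)
open import Data.List.Relation.Unary.Linked using (Linked; [-]; _∷_)
open import Data.Product using (_×_; _,_; ∃; ∃₂; proj₁; proj₂)
open import Data.Sum using (_⊎_; inj₁; inj₂)
open import Data.Empty using (⊥; ⊥-elim)
open import Relation.Nullary using (¬_; yes; no)
open import Relation.Binary.PropositionalEquality using (_≡_; _≢_; refl; sym; cong; subst)
open import Relation.Binary.Construct.Closure.ReflexiveTransitive using (ε; _◅_)

module _ {A : Set} where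

  -- The prefix of xs up to and including a given occurrence of y.  A path
  -- xs from x that later meets a neighbour y of x closes into the cycle
  -- (prefixTo xs i) ++ [ x ].
  prefixTo : ∀ {y : A} (xs : List A) → y ∈ xs → List A
  prefixTo (x ∷ xs) (here _)  = x ∷ []
  prefixTo (x ∷ xs) (there i) = x ∷ prefixTo xs i

  prefixTo-nonempty : ∀ {y : A} {xs : List A} (i : y ∈ xs) → 1 ≤ length (prefixTo xs i)
  prefixTo-nonempty (here _)  = s≤s z≤n
  prefixTo-nonempty (there _) = s≤s z≤n

  prefixTo-All : ∀ {P : A → Set} {y : A} {xs : List A} →
                 All P xs → (i : y ∈ xs) → All P (prefixTo xs i)
  prefixTo-All (p ∷ ps) (here _)  = p ∷ []
  prefixTo-All (p ∷ ps) (there i) = p ∷ prefixTo-All ps i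

  prefixTo-Unique : ∀ {y : A} {xs : List A} → Unique xs → (i : y ∈ xs) → Unique (prefixTo xs i)
  prefixTo-Unique (a ∷ u) (here _)  = [] ∷ []
  prefixTo-Unique (a ∷ u) (there i) = prefixTo-All a i ∷ prefixTo-Unique u i

  prefixTo-Linked : ∀ {R : A → A → Set} {y z : A} {xs : List A} →
                    Linked R xs → (i : y ∈ xs) → R y z →
                    Linked R (prefixTo xs i ++ z ∷ [])
  prefixTo-Linked [-]      (here refl)              r = r ∷ [-]
  prefixTo-Linked (_ ∷ _)  (here refl)              r = r ∷ [-]
  prefixTo-Linked (r′ ∷ l) (there (here refl))      r = r′ ∷ r ∷ [-]
  prefixTo-Linked (r′ ∷ l) (there i@(there _))      r = r′ ∷ prefixTo-Linked l i r

  lookup-injective : {xs : List A} → Unique xs → ∀ i j → lookup xs i ≡ lookup xs j → i ≡ j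
  lookup-injective (a ∷ u) Fin.zero    Fin.zero    _  = refl
  lookup-injective (a ∷ u) Fin.zero    (Fin.suc j) eq = ⊥-elim (All.lookup a (∈-lookup j) eq)
  lookup-injective (a ∷ u) (Fin.suc i) Fin.zero    eq = ⊥-elim (All.lookup a (∈-lookup i) (sym eq))
  lookup-injective (a ∷ u) (Fin.suc i) (Fin.suc j) eq = cong Fin.suc (lookup-injective u i j eq)

  twoOfThree : ∀ {P : A → Set} {q a b c : A} → a ≢ b → a ≢ c → b ≢ c →
               P a ⊎ a ≡ q → P b ⊎ b ≡ q → P c ⊎ c ≡ q →
               ∃₂ λ y z → y ≢ z × P y × P z
  twoOfThree {a = a} {b} a≢b _ _ (inj₁ pa) (inj₁ pb) _ = a , b , a≢b , pa , pb
  twoOfThree {a = a} {c = c} _ a≢c _ (inj₁ pa) (inj₂ refl) (inj₁ pc) = a , c , a≢c , pa , pc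
  twoOfThree {b = b} {c} _ _ b≢c (inj₂ refl) (inj₁ pb) (inj₁ pc) = b , c , b≢c , pb , pc
  twoOfThree _ _ b≢c (inj₁ _) (inj₂ refl) (inj₂ refl) = ⊥-elim (b≢c refl)
  twoOfThree _ a≢c _ (inj₂ refl) (inj₁ _) (inj₂ refl) = ⊥-elim (a≢c refl)
  twoOfThree a≢b _ _ (inj₂ refl) (inj₂ refl) _ = ⊥-elim (a≢b refl)

unique⇒length≤ : ∀ {n} {xs : List (Fin n)} → Unique xs → length xs ≤ n
unique⇒length≤ {xs = xs} u = injective⇒≤ {f = lookup xs} (lookup-injective u _ _)

anotherVertex : ∀ {n} → 2 ≤ n → (x : Fin n) → ∃ λ w → x ≢ w
anotherVertex (s≤s (s≤s _)) Fin.zero    = Fin.suc Fin.zero , λ ()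
anotherVertex (s≤s (s≤s _)) (Fin.suc _) = Fin.zero , λ ()

record ThreeNeighbours {n : ℕ} (rot : RotSys n) (x : Fin n) : Set where
  field
    a b c   : Fin n
    a≢b     : a ≢ b
    a≢c     : a ≢ c
    b≢c     : b ≢ c
    x∼a     : Adj rot x a
    x∼b     : Adj rot x b
    x∼c     : Adj rot x c

module PlaneTreeFacts {n : ℕ} (rot : RotSys n) (simple : IsSimpleRot rot) (acyclic : Acyclic rot) where

  open DecMembership (_≟_ {n}) using (_∈?_)

  Adj-sym : ∀ u v → Adj rot u v → Adj rot v u
  Adj-sym = proj₁ (proj₂ simple)

  Adj-irrefl : ∀ {u v} → Adj rot u v → u ≢ v
  Adj-irrefl {u} u∼v refl = proj₂ (proj₂ simple) u u∼v

  noFourCycle : ∀ {x y a b} → x ≢ y → a ≢ b →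
                Adj rot x a → Adj rot x b → Adj rot y a → Adj rot y b → ⊥
  noFourCycle {x} {y} {a} {b} x≢y a≢b x∼a x∼b y∼a y∼b =
    acyclic (x ∷ a ∷ y ∷ b ∷ []) (s≤s (s≤s (s≤s z≤n)) , distinct , adjacent)
    where
    distinct : Unique (x ∷ a ∷ y ∷ b ∷ [])
    distinct = (Adj-irrefl x∼a ∷ x≢y ∷ Adj-irrefl x∼b ∷ [])
             ∷ ((λ a≡y → Adj-irrefl y∼a (sym a≡y)) ∷ a≢b ∷ [])
             ∷ (Adj-irrefl y∼b ∷ [])
             ∷ [] ∷ []
    adjacent : Linked (Adj rot) (x ∷ a ∷ y ∷ b ∷ x ∷ [])
    adjacent = x∼a ∷ Adj-sym y a y∼a ∷ y∼b ∷ Adj-sym x b x∼b ∷ [-]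

  hasNeighbour : Connected rot → 2 ≤ n → ∀ x → ∃ λ y → Adj rot x y
  hasNeighbour connected n≥2 x with anotherVertex n≥2 x
  ... | w , x≢w with connected x w
  ...   | ε         = ⊥-elim (x≢w refl)
  ...   | x∼y ◅ _   = _ , x∼y

  threeNeighbours : Connected rot → 2 ≤ n → ∀ x → ¬ IsLeaf rot x → ¬ deg rot x ≡ 2 →
                    ThreeNeighbours rot x
  threeNeighbours connected n≥2 x notLeaf not2 with rot x in eq | proj₁ simple x
  ... | [] | _ = ⊥-elim (noNeighbour (hasNeighbour connected n≥2 x))
    where
    noNeighbour : (∃ λ y → Adj rot x y) → ⊥
    noNeighbour (y , x∼y) with subst (y ∈_) eq x∼y
    ... | ()
  ... | _ ∷ [] | _ = ⊥-elim (notLeaf refl)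
  ... | _ ∷ _ ∷ [] | _ = ⊥-elim (not2 refl)
  ... | a ∷ b ∷ c ∷ _ | (a≢b ∷ a≢c ∷ _) ∷ (b≢c ∷ _) ∷ _ = record
    { a≢b = a≢b ; a≢c = a≢c ; b≢c = b≢c
    ; x∼a = neighbour (here refl)
    ; x∼b = neighbour (there (here refl))
    ; x∼c = neighbour (there (there (here refl)))
    }
    where
    neighbour : ∀ {y} → y ∈ a ∷ b ∷ c ∷ _ → Adj rot x y
    neighbour = subst (_ ∈_) (sym eq)

  -- A path that starts x ∷ q ∷ … never meets a neighbour of x after q:
  -- otherwise the stretch from x to that neighbour closes a cycle.
  noChord : ∀ {x q y rest} → Unique (x ∷ q ∷ rest) → Linked (Adj rot) (x ∷ q ∷ rest) →
            y ∈ rest → Adj rot x y → ⊥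
  noChord {x} {q} {y} {rest} distinct adjacent i x∼y =
    acyclic (x ∷ q ∷ prefixTo rest i)
      ( s≤s (s≤s (prefixTo-nonempty i))
      , prefixTo-Unique distinct (there (there i))
      , prefixTo-Linked adjacent (there (there i)) (Adj-sym x y x∼y))

  Branching : (Fin n → Set) → Set
  Branching P = ∀ x q → P x → ∃ λ y → Adj rot x y × P y × y ≢ q

  module _ {P : Fin n → Set} (branching : Branching P) where

    record PathInto (k : ℕ) : Set where
      constructor path
      field
        tip prev : Fin n
        rest     : List (Fin n)
        size     : length rest ≡ k
        distinct : Unique (tip ∷ prev ∷ rest)
        adjacent : Linked (Adj rot) (tip ∷ prev ∷ rest)
        tip∈P    : P tip

    -- Branching at the tip, away from prev, yields a vertex not yet on the path.
    extend : ∀ {k} → PathInto k → PathInto (suc k)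
    extend (path x q rest size distinct adjacent x∈P)
      with branching x q x∈P
    ... | y , x∼y , y∈P , y≢q with y ∈? x ∷ q ∷ rest
    ...   | yes (here y≡x)         = ⊥-elim (Adj-irrefl x∼y (sym y≡x))
    ...   | yes (there (here y≡q)) = ⊥-elim (y≢q y≡q)
    ...   | yes (there (there i))  = ⊥-elim (noChord distinct adjacent i x∼y)
    ...   | no y∉path =
      path y x (q ∷ rest) (cong suc size)
        (¬Any⇒All¬ _ y∉path ∷ distinct) (Adj-sym x y x∼y ∷ adjacent) y∈P

    pathInto : ∀ v → P v → ∀ k → PathInto k
    pathInto v v∈P zero with branching v v v∈P
    ... | y , v∼y , y∈P , y≢v = path y v [] refl ((y≢v ∷ []) ∷ [] ∷ []) (Adj-sym v y v∼y ∷ [-]) y∈P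
    pathInto v v∈P (suc k) = extend (pathInto v v∈P k)

    -- A finite tree has no nonempty branching set: a path of n + 2 distinct
    -- vertices cannot exist.
    branchingSetEmpty : ∀ v → ¬ P v
    branchingSetEmpty v v∈P with pathInto v v∈P n
    ... | path _ _ rest size distinct _ _ =
      1+n≰n (≤-trans (n≤1+n _) (subst (λ m → suc (suc m) ≤ n) size (unique⇒length≤ distinct)))

module HalinAutomorphism {n : ℕ} (rot : RotSys n)
    (f : Fin n → Fin n) (automorphism : IsAutomorphism (HalinAdj rot) f)
    (fixesLeaves : ∀ v → IsLeaf rot v → f v ≡ v) where

  Moved : Fin n → Set
  Moved x = f x ≢ x

  -- The cycle C only joins leaves, so a Halin edge at a non-leaf is a tree edge.
  treeEdgeAtInternal : ∀ {u v} → ¬ IsLeaf rot u → HalinAdj rot u v → Adj rot u v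
  treeEdgeAtInternal _       (inj₁ u∼v)                   = u∼v
  treeEdgeAtInternal notLeaf (inj₂ (inj₁ (leaf , _)))     = ⊥-elim (notLeaf leaf)
  treeEdgeAtInternal notLeaf (inj₂ (inj₂ (_ , leaf , _))) = ⊥-elim (notLeaf leaf)

  -- Leaves are fixed and f is injective, so no moved vertex is sent to a leaf.
  imageOfMovedNotLeaf : ∀ {x} → Moved x → ¬ IsLeaf rot (f x)
  imageOfMovedNotLeaf moved leaf = moved (proj₁ (proj₁ automorphism) (fixesLeaves _ leaf))

  movedToFixed : ∀ {x a} → Moved x → Adj rot x a → f a ≡ a → Adj rot (f x) a
  movedToFixed {x} {a} moved x∼a fa≡a =
    subst (Adj rot (f x)) fa≡a
      (treeEdgeAtInternal (imageOfMovedNotLeaf moved) (proj₁ (proj₂ automorphism x a) (inj₁ x∼a)))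

  classify : ∀ {x y} q → Adj rot x y → (Moved y × y ≢ q) ⊎ ((Adj rot x y × f y ≡ y) ⊎ y ≡ q)
  classify {y = y} q x∼y with f y ≟ y | y ≟ q
  ... | yes fy≡y | _       = inj₂ (inj₁ (x∼y , fy≡y))
  ... | no moved | yes y≡q = inj₂ (inj₂ y≡q)
  ... | no moved | no y≢q  = inj₁ (moved , y≢q)

  module _ (simple : IsSimpleRot rot) (acyclic : Acyclic rot) where
    open PlaneTreeFacts rot simple acyclic

    -- x and f x would share two fixed neighbours of x: a 4-cycle.
    atMostOneFixedNeighbour : ∀ {x a b} → Moved x → a ≢ b → Adj rot x a → Adj rot x b →
                              f a ≡ a → f b ≡ b → ⊥
    atMostOneFixedNeighbour moved a≢b x∼a x∼b fa≡a fb≡b =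
      noFourCycle (λ x≡fx → moved (sym x≡fx)) a≢b x∼a x∼b
        (movedToFixed moved x∼a fa≡a) (movedToFixed moved x∼b fb≡b)

    -- Moved vertices have three neighbours, at most one of them fixed, so one
    -- of them is moved and differs from any given q.
    movedBranching : Connected rot → 2 ≤ n → (∀ v → ¬ deg rot v ≡ 2) → Branching Moved
    movedBranching connected n≥2 no2 x q moved
      with threeNeighbours connected n≥2 x (λ leaf → moved (fixesLeaves x leaf)) (no2 x)
    ... | record { a = a ; b = b ; c = c ; a≢b = a≢b ; a≢c = a≢c ; b≢c = b≢c
                 ; x∼a = x∼a ; x∼b = x∼b ; x∼c = x∼c }
      with classify q x∼a | classify q x∼b | classify q x∼c
    ... | inj₁ (m , ≢q) | _ | _ = a , x∼a , m , ≢q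
    ... | inj₂ _ | inj₁ (m , ≢q) | _ = b , x∼b , m , ≢q
    ... | inj₂ _ | inj₂ _ | inj₁ (m , ≢q) = c , x∼c , m , ≢q
    ... | inj₂ ca | inj₂ cb | inj₂ cc with twoOfThree a≢b a≢c b≢c ca cb cc
    ...   | _ , _ , y≢z , (x∼y , fy≡y) , (x∼z , fz≡z) =
      ⊥-elim (atMostOneFixedNeighbour moved y≢z x∼y x∼z fy≡y fz≡z)

mainTheorem6 : (n : ℕ) (rot : RotSys n) → 4 ≤ n → IsPlaneTree rot
    → (∀ v → ¬ deg rot v ≡ 2)
    → (f : Fin n → Fin n) → IsAutomorphism (HalinAdj rot) f
    → (∀ v → IsLeaf rot v → f v ≡ v)
    → ∀ v → f v ≡ v
mainTheorem6 n rot n≥4 (simple , connected , acyclic) no2 f automorphism fixesLeaves v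
  with f v ≟ v
... | yes fixed = fixed
... | no moved  = ⊥-elim (branchingSetEmpty movedSetBranching v moved)
  where
  open PlaneTreeFacts rot simple acyclic using (branchingSetEmpty)
  open HalinAutomorphism rot f automorphism fixesLeaves
  movedSetBranching : PlaneTreeFacts.Branching rot simple acyclic Moved
  movedSetBranching = movedBranching simple acyclic connected (≤-trans (s≤s (s≤s z≤n)) n≥4) no2
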